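{- Let $P_n$ ($n\ge1$) be a path with endpoints $x$ and $y$ (equal if $n=1$). Let $L$ be a list assignment such that $L(x)$ consists of a single colour from $\{0,\dots,6\}$ and, for every vertex $v\ne x$ of $P_n$, $L(v)\subseteq\{0,\dots,6\}$ contains $4$ cyclically consecutive colours (mod $7$). Then $P_n$ has an $L$-$(7,2)$-colouring.
   Context: An $L$-$(7,2)$-colouring is a map $f:V(P_n)\to\{0,\dots,6\}$ with $f(v)\in L(v)$ for all $v$ and $2\le|f(u)-f(v)|\le5$ for every edge $uv$. -}

module Defs where

open import Data.Nat using (ℕ; zero; suc; _+_; _≤_)
open import Data.Nat.DivMod using (_mod_)
open import Data.Fin using (Fin; toℕ; fromℕ<; inject₁; zero; suc)
open import Data.Fin.Subset using (Subset; _∈_; ⁅_⁆)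
open import Data.Product using (Σ; ∃; _×_; _,_)
open import Data.Nat using (∣_-_∣)

Colour : Set
Colour = Fin 7

_⊕_ : Colour → ℕ → Colour
c ⊕ k = (toℕ c + k) mod 7

Contains4CyclicConsecutive : Subset 7 → Set
Contains4CyclicConsecutive S =
  ∃ λ (a : Colour) → (a ⊕ 0) ∈ S × (a ⊕ 1) ∈ S × (a ⊕ 2) ∈ S × (a ⊕ 3) ∈ S

-- The path P_n on vertex set Fin n with edges {i, i+1}; here n = suc m.
-- Endpoint x is vertex zero, y is vertex m.
-- Edge i — i+1 for i : Fin m is  inject₁ i — suc i.

Sep72 : Colour → Colour → Set
Sep72 a b = 2 ≤ ∣ toℕ a - toℕ b ∣ × ∣ toℕ a - toℕ b ∣ ≤ 5

IsL72Colouring : (m : ℕ) → (Fin (suc m) → Subset 7) → (Fin (suc m) → Colour) → Set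
IsL72Colouring m L f =
  ((v : Fin (suc m)) → f v ∈ L v) ×
  ((i : Fin m) → Sep72 (f (inject₁ i)) (f (suc i)))

module Submission where

open import Defs
open import Data.Nat using (ℕ; suc; _≤?_)
open import Data.Fin using (Fin; zero; suc; toℕ; inject₁)
open import Data.Fin.Properties using (all?; any?)
open import Data.Fin.Subset using (Subset; ⁅_⁆; _∈_)
open import Data.Fin.Subset.Properties using (x∈⁅x⁆)
open import Data.Product using (∃; _×_; _,_)
open import Data.Vec.Functional using (_∷_; tail)
open import Relation.Nullary using (Dec)
open import Relation.Nullary.Decidable using (from-yes; _×-dec_)
open import Relation.Binary.PropositionalEquality using (_≡_; refl; subst; sym)

sep72? : (a b : Colour) → Dec (Sep72 a b)
sep72? a b = (2 ≤? _) ×-dec (_ ≤? 5)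

Sep72AmongFour : Colour → Colour → Set
Sep72AmongFour p a = ∃ λ (k : Fin 4) → Sep72 p (a ⊕ toℕ k)

-- The colours not separated from p are exactly p - 1, p, p + 1 (mod 7), since
-- 0 and 6 are at distance 6, so four cyclically consecutive colours cannot all
-- be excluded; the proof checks this by exhaustive evaluation.
sep72-among-four : (p a : Colour) → Sep72AmongFour p a
sep72-among-four = from-yes (all? λ p → all? λ a → sep72-among-four? p a)
  where
  sep72-among-four? : (p a : Colour) → Dec (Sep72AmongFour p a)
  sep72-among-four? p a = any? λ k → sep72? p (a ⊕ toℕ k)

sep72-in-consecutive4 : (p : Colour) (S : Subset 7) →
  Contains4CyclicConsecutive S → ∃ λ q → q ∈ S × Sep72 p q
sep72-in-consecutive4 p S (a , a+0∈S , a+1∈S , a+2∈S , a+3∈S) with sep72-among-four p a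
... | zero , sep = _ , a+0∈S , sep
... | suc zero , sep = _ , a+1∈S , sep
... | suc (suc zero) , sep = _ , a+2∈S , sep
... | suc (suc (suc zero)) , sep = _ , a+3∈S , sep

greedy-colouring : (m : ℕ) (L : Fin (suc m) → Subset 7) (c : Colour) → c ∈ L zero →
  ((v : Fin m) → Contains4CyclicConsecutive (L (suc v))) →
  ∃ λ (f : Fin (suc m) → Colour) → f zero ≡ c × IsL72Colouring m L f
greedy-colouring ℕ.zero L c c∈L₀ _ = (λ _ → c) , refl , (λ { zero → c∈L₀ }) , (λ ())
greedy-colouring (suc m) L c c∈L₀ consecutive
  with sep72-in-consecutive4 c (L (suc zero)) (consecutive zero)
... | q , q∈L₁ , sep with greedy-colouring m (tail L) q q∈L₁ (λ v → consecutive (suc v))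
... | f , refl , f∈L , f-sep = c ∷ f , refl , ∷∈L , ∷-sep
  where
  ∷∈L : (v : Fin (suc (suc m))) → (c ∷ f) v ∈ L v
  ∷∈L zero = c∈L₀
  ∷∈L (suc v) = f∈L v

  ∷-sep : (i : Fin (suc m)) → Sep72 ((c ∷ f) (inject₁ i)) ((c ∷ f) (suc i))
  ∷-sep zero = sep
  ∷-sep (suc i) = f-sep i

proposition4p1 : (m : ℕ) → (L : Fin (suc m) → Subset 7) →
    (∃ λ (c : Colour) → L zero ≡ ⁅ c ⁆) →
    ((v : Fin m) → Contains4CyclicConsecutive (L (suc v))) →
    ∃ λ (f : Fin (suc m) → Colour) → IsL72Colouring m L f
proposition4p1 m L (c , L₀≡⁅c⁆) consecutive
  with greedy-colouring m L c (subst (c ∈_) (sym L₀≡⁅c⁆) (x∈⁅x⁆ c)) consecutive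
... | f , _ , colouring = f , colouring
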